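{- If $T$ is the corona of a tree and $T$ has order $n$, then $\operatorname{fd}(T) = n/2$. Further, $V(T)$ can be partitioned into two FD-sets of $T$ each of cardinality $\operatorname{fd}(T)$.
   Context: All graphs are finite and simple; $N(v)$ denotes the open neighborhood of $v$. The corona of a graph $H$ is the graph of order $2|V(H)|$ obtained from $H$ by attaching a new leaf (pendant vertex) to each vertex of $H$. For a graph $G=(V,E)$ and an integer $k \ge 1$, a $k$-fair dominating set is a dominating set $D \subseteq V$ such that $|N(v) \cap D| = k$ for every $v \in V \setminus D$ (the set $D = V$ qualifies vacuously). A fair dominating set (FD-set) is a set that is a $k$-fair dominating set for some $k \ge 1$. If $G$ has at least one edge, $\operatorname{fd}(G)$ is the minimum cardinality of an FD-set of $G$; by convention, $\operatorname{fd}(\overline{K_n}) = n$. -}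

module Defs where

open import Data.Nat using (ℕ; zero; suc; _+_; _≤_; _≥_)
open import Data.Fin using (Fin; splitAt)
open import Data.Fin.Subset using (Subset; _∈_; _∉_; _∩_; ∣_∣)
open import Data.Vec using (tabulate)
open import Data.Bool using (Bool; true; false)
open import Data.Sum using (_⊎_; inj₁; inj₂)
open import Data.Product using (Σ; ∃; _×_; _,_)
open import Data.List using (List; []; _∷_; length)
open import Data.List.Relation.Unary.Unique.Propositional using (Unique)
open import Relation.Nullary using (¬_; does)
open import Relation.Binary.PropositionalEquality using (_≡_; refl)
import Data.Fin.Properties as FinP

record Graph (n : ℕ) : Set where
  field
    adj    : Fin n → Fin n → Bool
    sym    : ∀ u v → adj u v ≡ adj v u
    irrefl : ∀ v → adj v v ≡ false
open Graph public

Adj : ∀ {n} → Graph n → Fin n → Fin n → Set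
Adj G u v = adj G u v ≡ true

data Walk {n} (G : Graph n) : Fin n → Fin n → Set where
  here : ∀ {v} → Walk G v v
  step : ∀ {u w v} → Adj G u w → Walk G w v → Walk G u v

Connected : ∀ {n} → Graph n → Set
Connected G = ∀ u v → Walk G u v

ChainTo : ∀ {n} → Graph n → List (Fin n) → Fin n → Set
ChainTo G []       _ = Data.Unit.⊤ where import Data.Unit
ChainTo G (x ∷ xs) w = Adj G w x × ChainTo G xs x

record Cycle {n} (G : Graph n) : Set where
  field
    start    : Fin n
    rest     : List (Fin n)
    long     : length rest ≥ 2
    distinct : Unique (start ∷ rest)
    chain    : ChainTo G rest start
    last     : Fin n
    lastIs   : ∃ λ (pre : List (Fin n)) → rest ≡ pre Data.List.++ (last ∷ [])
    closes   : Adj G last start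

Acyclic : ∀ {n} → Graph n → Set
Acyclic G = ¬ Cycle G

IsTree : ∀ {n} → Graph n → Set
IsTree {n} G = (n ≥ 1) × Connected G × Acyclic G

-- Corona: vertices Fin (m + m); the first copy (inj₁ i) is H, the second
-- copy (inj₂ i) is the leaf attached to vertex i.
coronaAdj′ : ∀ {m} → Graph m → Fin m ⊎ Fin m → Fin m ⊎ Fin m → Bool
coronaAdj′ H (inj₁ i) (inj₁ j) = adj H i j
coronaAdj′ H (inj₁ i) (inj₂ j) = does (i FinP.≟ j)
coronaAdj′ H (inj₂ i) (inj₁ j) = does (i FinP.≟ j)
coronaAdj′ H (inj₂ i) (inj₂ j) = false

private
  ≟-sym : ∀ {m} (i j : Fin m) → does (i FinP.≟ j) ≡ does (j FinP.≟ i)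
  ≟-sym i j with i FinP.≟ j | j FinP.≟ i
  ... | Relation.Nullary.yes _ | Relation.Nullary.yes _ = refl
  ... | Relation.Nullary.no _  | Relation.Nullary.no _  = refl
  ... | Relation.Nullary.yes p | Relation.Nullary.no q  = Data.Empty.⊥-elim (q (Relation.Binary.PropositionalEquality.sym p))
    where import Data.Empty
  ... | Relation.Nullary.no p  | Relation.Nullary.yes q = Data.Empty.⊥-elim (p (Relation.Binary.PropositionalEquality.sym q))
    where import Data.Empty

  coronaSym′ : ∀ {m} (H : Graph m) x y → coronaAdj′ H x y ≡ coronaAdj′ H y x
  coronaSym′ H (inj₁ i) (inj₁ j) = sym H i j
  coronaSym′ H (inj₁ i) (inj₂ j) = ≟-sym i j
  coronaSym′ H (inj₂ i) (inj₁ j) = ≟-sym i j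
  coronaSym′ H (inj₂ i) (inj₂ j) = refl

  coronaIrr′ : ∀ {m} (H : Graph m) x → coronaAdj′ H x x ≡ false
  coronaIrr′ H (inj₁ i) = irrefl H i
  coronaIrr′ H (inj₂ i) = refl

corona : ∀ {m} → Graph m → Graph (m + m)
corona {m} H = record
  { adj    = λ x y → coronaAdj′ H (splitAt m x) (splitAt m y)
  ; sym    = λ x y → coronaSym′ H (splitAt m x) (splitAt m y)
  ; irrefl = λ x → coronaIrr′ H (splitAt m x)
  }

N : ∀ {n} → Graph n → Fin n → Subset n
N G v = tabulate (adj G v)

Dominating : ∀ {n} → Graph n → Subset n → Set
Dominating G D = ∀ v → v ∉ D → ∃ λ u → u ∈ D × Adj G v u

KFair : ∀ {n} → Graph n → ℕ → Subset n → Set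
KFair G k D = Dominating G D × (∀ v → v ∉ D → ∣ N G v ∩ D ∣ ≡ k)

IsFD : ∀ {n} → Graph n → Subset n → Set
IsFD G D = ∃ λ k → k ≥ 1 × KFair G k D

-- fd(G) = f : f is the minimum cardinality of an FD-set.
-- (For edgeless graphs the only FD-set is V, matching fd(K̄ₙ) = n.)
IsFdNumber : ∀ {n} → Graph n → ℕ → Set
IsFdNumber G f = (∃ λ D → IsFD G D × ∣ D ∣ ≡ f) × (∀ D → IsFD G D → f ≤ ∣ D ∣)

-- Every dominating set of a corona contains, for each vertex of the base graph,
-- the vertex or its leaf, so it has at least half of the vertices.  Conversely
-- the base vertices, and likewise the leaves, form a perfect dominating set:
-- every vertex outside it has exactly one neighbour inside.  Such a set is
-- 1-fair, and the two sets partition the vertex set.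
module Submission where

open import Defs hiding (sym)
open import Data.Bool using (true)
open import Data.Empty using (⊥-elim)
open import Data.Fin using (Fin; _↑ˡ_; _↑ʳ_; splitAt)
open import Data.Fin.Properties using (_≟_; splitAt-↑ˡ; splitAt-↑ʳ; splitAt⁻¹-↑ˡ; splitAt⁻¹-↑ʳ)
open import Data.Fin.Subset
  using (Subset; inside; outside; _∈_; _∉_; _∩_; _∪_; _⊆_; ⊤; ⊥; ⁅_⁆; ∣_∣)
open import Data.Fin.Subset.Properties
  using (_∈?_; ∈⊤; ∉⊥; ∣⊤∣≡n; ∣⊥∣≡0; ∣p∣≤∣x∷p∣; x∈⁅x⁆; x∈⁅y⁆⇒x≡y; ∣⁅x⁆∣≡1;
         ⊆-antisym; p⊆q⇒∣p∣≤∣q∣; x∈p∪q⁺; x∈p∩q⁺; x∈p∩q⁻)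
open import Data.Nat using (ℕ; suc; _+_; _*_; _/_; _≤_; z≤n; s≤s)
open import Data.Nat.DivMod using (m*n/n≡m)
open import Data.Nat.Properties using (+-suc; +-identityʳ; *-comm; +-monoʳ-≤; ≤-trans; ≤-reflexive; module ≤-Reasoning)
open import Data.Product using (∃; _×_; _,_)
open import Data.Sum using (_⊎_; inj₁; inj₂)
import Data.Sum as Sum
open import Data.Vec using ([]; _∷_; _++_; lookup)
import Data.Vec as Vec
open import Data.Vec.Properties using (lookup-++ˡ; lookup-++ʳ; lookup∘tabulate; []=⇒lookup; lookup⇒[]=)
open import Function using (_∘_)
open import Function.Bundles using (_⇔_; mk⇔; Equivalence)
open import Relation.Nullary using (¬_; Dec; does; yes; no)
open import Relation.Binary.PropositionalEquality using (_≡_; refl; sym; trans; cong; cong₂; subst; module ≡-Reasoning)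

open Equivalence using (to; from)

does≡true⇔ : ∀ {a} {A : Set a} (a? : Dec A) → does a? ≡ true ⇔ A
does≡true⇔ (yes a)  = mk⇔ (λ _ → a) (λ _ → refl)
does≡true⇔ (no ¬a) = mk⇔ (λ ()) (⊥-elim ∘ ¬a)

[m+m]/2≡m : ∀ m → (m + m) / 2 ≡ m
[m+m]/2≡m m = begin
  (m + m) / 2   ≡⟨ cong (λ k → (m + k) / 2) (sym (+-identityʳ m)) ⟩
  (2 * m) / 2   ≡⟨ cong (_/ 2) (*-comm 2 m) ⟩
  (m * 2) / 2   ≡⟨ m*n/n≡m m 2 ⟩
  m             ∎
  where open ≡-Reasoning

lookup≡⇒∈⇔∈ : ∀ {m n} {p : Subset m} {q : Subset n} {x y} →
              lookup p x ≡ lookup q y → x ∈ p ⇔ y ∈ q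
lookup≡⇒∈⇔∈ eq = mk⇔ (λ x∈p → lookup⇒[]= _ _ (trans (sym eq) ([]=⇒lookup x∈p)))
                     (λ y∈q → lookup⇒[]= _ _ (trans eq ([]=⇒lookup y∈q)))

↑ˡ∈p++q⇔∈p : ∀ {m n} (p : Subset m) (q : Subset n) i → i ↑ˡ n ∈ p ++ q ⇔ i ∈ p
↑ˡ∈p++q⇔∈p p q i = lookup≡⇒∈⇔∈ (lookup-++ˡ p q i)

↑ʳ∈p++q⇔∈q : ∀ {m n} (p : Subset m) (q : Subset n) i → m ↑ʳ i ∈ p ++ q ⇔ i ∈ q
↑ʳ∈p++q⇔∈q p q i = lookup≡⇒∈⇔∈ (lookup-++ʳ p q i)

∣p++q∣≡∣p∣+∣q∣ : ∀ {m n} (p : Subset m) (q : Subset n) → ∣ p ++ q ∣ ≡ ∣ p ∣ + ∣ q ∣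
∣p++q∣≡∣p∣+∣q∣ []            q = refl
∣p++q∣≡∣p∣+∣q∣ (outside ∷ p) q = ∣p++q∣≡∣p∣+∣q∣ p q
∣p++q∣≡∣p∣+∣q∣ (inside  ∷ p) q = cong suc (∣p++q∣≡∣p∣+∣q∣ p q)

∣p∪q∣≤∣p∣+∣q∣ : ∀ {n} (p q : Subset n) → ∣ p ∪ q ∣ ≤ ∣ p ∣ + ∣ q ∣
∣p∪q∣≤∣p∣+∣q∣ []            []            = z≤n
∣p∪q∣≤∣p∣+∣q∣ (inside  ∷ p) (s ∷ q)       =
  s≤s (≤-trans (∣p∪q∣≤∣p∣+∣q∣ p q) (+-monoʳ-≤ ∣ p ∣ (∣p∣≤∣x∷p∣ s q)))
∣p∪q∣≤∣p∣+∣q∣ (outside ∷ p) (inside  ∷ q) =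
  ≤-trans (s≤s (∣p∪q∣≤∣p∣+∣q∣ p q)) (≤-reflexive (sym (+-suc ∣ p ∣ ∣ q ∣)))
∣p∪q∣≤∣p∣+∣q∣ (outside ∷ p) (outside ∷ q) = ∣p∪q∣≤∣p∣+∣q∣ p q

covering⇒n≤∣p∣+∣q∣ : ∀ {n} (p q : Subset n) → (∀ x → x ∈ p ⊎ x ∈ q) → n ≤ ∣ p ∣ + ∣ q ∣
covering⇒n≤∣p∣+∣q∣ {n} p q covering = begin
  n             ≡⟨ sym (∣⊤∣≡n n) ⟩
  ∣ ⊤ {n} ∣     ≤⟨ p⊆q⇒∣p∣≤∣q∣ {p = ⊤} (λ {x} _ → x∈p∪q⁺ (covering x)) ⟩
  ∣ p ∪ q ∣     ≤⟨ ∣p∪q∣≤∣p∣+∣q∣ p q ⟩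
  ∣ p ∣ + ∣ q ∣ ∎
  where open ≤-Reasoning

∣p∣≡1 : ∀ {n} {p : Subset n} {x} → x ∈ p → (∀ {y} → y ∈ p → y ≡ x) → ∣ p ∣ ≡ 1
∣p∣≡1 {p = p} {x} x∈p unique = trans (cong ∣_∣ (⊆-antisym p⊆⁅x⁆ ⁅x⁆⊆p)) (∣⁅x⁆∣≡1 x)
  where
  p⊆⁅x⁆ : p ⊆ ⁅ x ⁆
  p⊆⁅x⁆ y∈p = subst (_∈ ⁅ x ⁆) (sym (unique y∈p)) (x∈⁅x⁆ x)
  ⁅x⁆⊆p : ⁅ x ⁆ ⊆ p
  ⁅x⁆⊆p {y} y∈⁅x⁆ = subst (_∈ p) (sym (x∈⁅y⁆⇒x≡y x y∈⁅x⁆)) x∈p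

module _ {n} (G : Graph n) where

  ∈N⇔Adj : ∀ {v u} → u ∈ N G v ⇔ Adj G v u
  ∈N⇔Adj {v} {u} = mk⇔ (λ u∈N → trans (sym (lookup∘tabulate (adj G v) u)) ([]=⇒lookup u∈N))
                       (λ adj≡ → lookup⇒[]= u _ (trans (lookup∘tabulate (adj G v) u) adj≡))

  ∈N∩D⇔ : ∀ {v u} {D : Subset n} → u ∈ N G v ∩ D ⇔ (u ∈ D × Adj G v u)
  ∈N∩D⇔ {D = D} = mk⇔ (λ u∈ → let u∈N , u∈D = x∈p∩q⁻ _ D u∈ in u∈D , to ∈N⇔Adj u∈N)
                      (λ (u∈D , vu) → x∈p∩q⁺ (from ∈N⇔Adj vu , u∈D))

  PerfectDominating : Subset n → Set
  PerfectDominating D = ∀ v → v ∉ D →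
    ∃ λ u → (u ∈ D × Adj G v u) × (∀ w → w ∈ D → Adj G v w → w ≡ u)

  perfect⇒IsFD : ∀ {D} → PerfectDominating D → IsFD G D
  perfect⇒IsFD perfect = 1 , s≤s z≤n , dominating , one-neighbour
    where
    dominating : Dominating G _
    dominating v v∉D = let u , u∈D×vu , _ = perfect v v∉D in u , u∈D×vu
    one-neighbour : ∀ v → v ∉ _ → ∣ N G v ∩ _ ∣ ≡ 1
    one-neighbour v v∉D =
      let u , u∈D×vu , unique = perfect v v∉D
      in ∣p∣≡1 (from ∈N∩D⇔ u∈D×vu) (λ w∈ → let w∈D , vw = to ∈N∩D⇔ w∈ in unique _ w∈D vw)

module Corona {m} (H : Graph m) where

  hub leaf : Fin m → Fin (m + m)
  hub  i = i ↑ˡ m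
  leaf i = m ↑ʳ i

  data HubOrLeaf : Fin (m + m) → Set where
    hub-of  : ∀ i → HubOrLeaf (hub i)
    leaf-of : ∀ i → HubOrLeaf (leaf i)

  hubOrLeaf : ∀ x → HubOrLeaf x
  hubOrLeaf x with splitAt m x in eq
  ... | inj₁ i = subst HubOrLeaf (splitAt⁻¹-↑ˡ eq) (hub-of i)
  ... | inj₂ i = subst HubOrLeaf (splitAt⁻¹-↑ʳ eq) (leaf-of i)

  leaf-hub-adj⇔≡ : ∀ i j → Adj (corona H) (leaf i) (hub j) ⇔ i ≡ j
  leaf-hub-adj⇔≡ i j rewrite splitAt-↑ʳ m m i | splitAt-↑ˡ m j m = does≡true⇔ (i ≟ j)

  hub-leaf-adj⇔≡ : ∀ i j → Adj (corona H) (hub i) (leaf j) ⇔ i ≡ j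
  hub-leaf-adj⇔≡ i j rewrite splitAt-↑ˡ m i m | splitAt-↑ʳ m m j = does≡true⇔ (i ≟ j)

  leaf-leaf-¬adj : ∀ i j → ¬ Adj (corona H) (leaf i) (leaf j)
  leaf-leaf-¬adj i j rewrite splitAt-↑ʳ m m i | splitAt-↑ʳ m m j = λ ()

  hubs leaves : Subset (m + m)
  hubs   = ⊤ {m} ++ ⊥ {m}
  leaves = ⊥ {m} ++ ⊤ {m}

  hub∈hubs : ∀ i → hub i ∈ hubs
  hub∈hubs i = from (↑ˡ∈p++q⇔∈p (⊤ {m}) (⊥ {m}) i) ∈⊤

  leaf∉hubs : ∀ i → leaf i ∉ hubs
  leaf∉hubs i = ∉⊥ ∘ to (↑ʳ∈p++q⇔∈q (⊤ {m}) (⊥ {m}) i)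

  leaf∈leaves : ∀ i → leaf i ∈ leaves
  leaf∈leaves i = from (↑ʳ∈p++q⇔∈q (⊥ {m}) (⊤ {m}) i) ∈⊤

  hub∉leaves : ∀ i → hub i ∉ leaves
  hub∉leaves i = ∉⊥ ∘ to (↑ˡ∈p++q⇔∈p (⊥ {m}) (⊤ {m}) i)

  ∣hubs∣≡m : ∣ hubs ∣ ≡ m
  ∣hubs∣≡m = begin
    ∣ ⊤ {m} ++ ⊥ {m} ∣   ≡⟨ ∣p++q∣≡∣p∣+∣q∣ (⊤ {m}) (⊥ {m}) ⟩
    ∣ ⊤ {m} ∣ + ∣ ⊥ {m} ∣ ≡⟨ cong₂ _+_ (∣⊤∣≡n m) (∣⊥∣≡0 m) ⟩
    m + 0                ≡⟨ +-identityʳ m ⟩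
    m                    ∎
    where open ≡-Reasoning

  ∣leaves∣≡m : ∣ leaves ∣ ≡ m
  ∣leaves∣≡m = trans (∣p++q∣≡∣p∣+∣q∣ (⊥ {m}) (⊤ {m})) (cong₂ _+_ (∣⊥∣≡0 m) (∣⊤∣≡n m))

  hubs-perfect : PerfectDominating (corona H) hubs
  hubs-perfect x x∉hubs with hubOrLeaf x
  ... | hub-of i  = ⊥-elim (x∉hubs (hub∈hubs i))
  ... | leaf-of i = hub i , (hub∈hubs i , from (leaf-hub-adj⇔≡ i i) refl) , unique
    where
    unique : ∀ w → w ∈ hubs → Adj (corona H) (leaf i) w → w ≡ hub i
    unique w w∈hubs adj with hubOrLeaf w
    ... | hub-of j  = cong hub (sym (to (leaf-hub-adj⇔≡ i j) adj))
    ... | leaf-of j = ⊥-elim (leaf∉hubs j w∈hubs)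

  leaves-perfect : PerfectDominating (corona H) leaves
  leaves-perfect x x∉leaves with hubOrLeaf x
  ... | leaf-of i = ⊥-elim (x∉leaves (leaf∈leaves i))
  ... | hub-of i  = leaf i , (leaf∈leaves i , from (hub-leaf-adj⇔≡ i i) refl) , unique
    where
    unique : ∀ w → w ∈ leaves → Adj (corona H) (hub i) w → w ≡ leaf i
    unique w w∈leaves adj with hubOrLeaf w
    ... | hub-of j  = ⊥-elim (hub∉leaves j w∈leaves)
    ... | leaf-of j = cong leaf (sym (to (hub-leaf-adj⇔≡ i j) adj))

  hubs-leaves-partition : ∀ x → (x ∈ hubs ⊎ x ∈ leaves) × ¬ (x ∈ hubs × x ∈ leaves)
  hubs-leaves-partition x with hubOrLeaf x
  ... | hub-of i  = inj₁ (hub∈hubs i) , λ (_ , x∈leaves) → hub∉leaves i x∈leaves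
  ... | leaf-of i = inj₂ (leaf∈leaves i) , λ (x∈hubs , _) → leaf∉hubs i x∈hubs

  dominating⇒hub∈⊎leaf∈ : ∀ {D} → Dominating (corona H) D → ∀ i → hub i ∈ D ⊎ leaf i ∈ D
  dominating⇒hub∈⊎leaf∈ {D} dominating i with leaf i ∈? D
  ... | yes leaf∈D = inj₂ leaf∈D
  ... | no  leaf∉D with dominating (leaf i) leaf∉D
  ...   | u , u∈D , adj with hubOrLeaf u
  ...     | hub-of j  = inj₁ (subst (λ k → hub k ∈ D) (sym (to (leaf-hub-adj⇔≡ i j) adj)) u∈D)
  ...     | leaf-of j = ⊥-elim (leaf-leaf-¬adj i j adj)

  dominating⇒m≤∣D∣ : ∀ {D} → Dominating (corona H) D → m ≤ ∣ D ∣
  dominating⇒m≤∣D∣ {D} dominating with Vec.splitAt m D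
  ... | p , q , refl = ≤-trans
    (covering⇒n≤∣p∣+∣q∣ p q (Sum.map (to (↑ˡ∈p++q⇔∈p p q _)) (to (↑ʳ∈p++q⇔∈q p q _))
                              ∘ dominating⇒hub∈⊎leaf∈ dominating))
    (≤-reflexive (sym (∣p++q∣≡∣p∣+∣q∣ p q)))

  fd[corona]≡m : IsFdNumber (corona H) m
  fd[corona]≡m = (hubs , perfect⇒IsFD (corona H) hubs-perfect , ∣hubs∣≡m)
               , λ D (_ , _ , dominating , _) → dominating⇒m≤∣D∣ dominating

mainTheorem9 : ∀ (m : ℕ) (H : Graph m) → IsTree H →
    IsFdNumber (corona H) ((m + m) / 2) ×
    ∃ λ (D₁ : Subset (m + m)) → ∃ λ (D₂ : Subset (m + m)) →
    IsFD (corona H) D₁ × IsFD (corona H) D₂ ×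
    ∣ D₁ ∣ ≡ (m + m) / 2 × ∣ D₂ ∣ ≡ (m + m) / 2 ×
    (∀ v → (v ∈ D₁ ⊎ v ∈ D₂) × ¬ (v ∈ D₁ × v ∈ D₂))
mainTheorem9 m H _ rewrite [m+m]/2≡m m =
  fd[corona]≡m , hubs , leaves ,
  perfect⇒IsFD (corona H) hubs-perfect , perfect⇒IsFD (corona H) leaves-perfect ,
  ∣hubs∣≡m , ∣leaves∣≡m , hubs-leaves-partition
  where open Corona H
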